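{- Let $\mathcal{G}$ be a finite quiver (self-loops allowed, at most one directed edge from any vertex to any other vertex), and let $\Sigma_{\mathcal{G};\alpha\omega}$ denote the formal sum of all walks from $\alpha$ to $\omega$ on $\mathcal{G}$. Then, in vertex-edge notation, $$\Sigma_{\mathcal{G};\alpha\omega}=\sum_{(\alpha\nu_2\cdots\nu_p\omega)\in\Pi_{\mathcal{G};\alpha\omega}}(\alpha)'_{\mathcal{G}}(\alpha\nu_2)(\nu_2)'_{\mathcal{G}\setminus\{\alpha\}}\cdots(\nu_p\omega)(\omega)'_{\mathcal{G}\setminus\{\alpha,\nu_2,\dots,\nu_p\}},$$ where $p$ is the length of the simple path, and the dressed vertex $(\alpha)'_{\mathcal{H}}$ of a vertex $\alpha$ on a quiver $\mathcal{H}$ is defined recursively by $$(\alpha)'_{\mathcal{H}}=\Bigg[(\alpha)-\sum_{(\alpha\mu_2\cdots\mu_m\alpha)\in\Gamma_{\mathcal{H};\alpha}}(\alpha)(\alpha\mu_2)(\mu_2)'_{\mathcal{H}\setminus\{\alpha\}}(\mu_2\mu_3)\cdots(\mu_m)'_{\mathcal{H}\setminus\{\alpha,\mu_2,\dots,\mu_{m-1}\}}(\mu_m\alpha)(\alpha)\Bigg]^{ -1},$$ with $m$ the length of the (non-trivial) simple cycle; the recursion stops at a vertex $\mu$ with no neighbour in the current subquiver $\mathcal{H}'$, where $(\mu)'_{\mathcal{H}'}=[(\mu)-(\mu\mu)]^{ -1}$ if the loop $(\mu\mu)$ exists and $(\mu)'_{\mathcal{H}'}=(\mu)$ otherwise.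 Consequently $\Sigma_{\mathcal{G};\alpha\omega}$ is expressed as a continued fraction of finite depth over the simple paths and simple cycles of $\mathcal{G}$.
   Context: A walk of length $n\ge1$ is a sequence of contiguous edges $(\mu_0\mu_1)\cdots(\mu_{n-1}\mu_n)$; in vertex-edge notation it is written $(\mu_0)(\mu_0\mu_1)(\mu_1)\cdots(\mu_{n-1}\mu_n)(\mu_n)$, and juxtaposition of such strings denotes concatenation of walks, extended bilinearly to formal sums; $(\mu)$ denotes the trivial (length $0$) walk at $\mu$, which acts as a local identity. A cycle off $\mu_0$ has $\mu_0=\mu_n$. A simple path is an open walk whose vertices are all distinct; $\Pi_{\mathcal{G};\alpha\omega}$ is the set of simple paths from $\alpha$ to $\omega$ (for $\alpha=\omega$ it is $\{(\alpha)\}$). A simple cycle is a cycle whose internal vertices are all distinct and different from its initial vertex; $\Gamma_{\mathcal{H};\alpha}$ is the set of simple cycles off $\alpha$ on $\mathcal{H}$. $\mathcal{H}\setminus\{\alpha,\dots\}$ denotes deletion of these vertices and incident edges. For a formal sum $S$ of cycles off $\alpha$, $[(\alpha)-S]^{ -1}$ denotes the formal series $\sum_{k\ge0}S^k$ (with $S^0=(\alpha)$ and powers taken by concatenation), i.e. the sum over the Kleene star of $S$. -}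

module Defs where

open import Data.Nat using (ℕ)
open import Data.Fin using (Fin)
open import Data.Bool using (Bool; T)
open import Data.List using (List; []; _∷_)
open import Data.List.Relation.Unary.All using (All)
open import Data.List.Relation.Unary.Unique.Propositional using (Unique)
open import Data.Fin.Subset using (Subset; _∈_; _-_) renaming (⊤ to full)
open import Data.Product using (_×_)

-- A finite quiver on the vertex set Fin n: E a b = true iff there is a
-- (unique) directed edge a → b.
module Quiver (n : ℕ) (E : Fin n → Fin n → Bool) where

  Edge : Fin n → Fin n → Set
  Edge a b = T (E a b)

  data Walk : Fin n → Fin n → Set where
    triv : (a : Fin n) → Walk a a
    step : ∀ {a b c} → Edge a b → Walk b c → Walk a c

  _++w_ : ∀ {a b c} → Walk a b → Walk b c → Walk a c
  triv _   ++w v = v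
  step e w ++w v = step e (w ++w v)

  verts : ∀ {a b} → Walk a b → List (Fin n)
  verts (triv a) = a ∷ []
  verts (step {a} e w) = a ∷ verts w

  initVerts : ∀ {a b} → Walk a b → List (Fin n)
  initVerts (triv a) = []
  initVerts (step {a} e w) = a ∷ initVerts w

  -- simple path: open walk whose vertices are all distinct
  -- (for α = ω only the trivial walk qualifies)
  IsSimplePath : ∀ {a b} → Walk a b → Set
  IsSimplePath w = Unique (verts w)

  -- A non-trivial cycle (α μ₂ ⋯ μₘ α) = step e w, with w : Walk μ₂ α,
  -- is a simple cycle off α on the induced subquiver with vertex set H iff
  -- its internal vertices μ₂ … μₘ (= initVerts w) are distinct and
  -- different from α, and all of its vertices lie in H.
  IsSimpleCycleOn : Subset n → ∀ {a b} → Edge a b → Walk b a → Set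
  IsSimpleCycleOn H {a} e w =
    Unique (a ∷ initVerts w) × All (_∈ H) (verts (step e w))

  mutual
    -- Dressed R a: index set of the formal sum (a)'_R, i.e. the Kleene
    -- star of the sum of "dressed simple cycles" off a on R:
    -- a finite sequence of dressed simple cycles (none = the trivial walk (a)).
    data Dressed (R : Subset n) (a : Fin n) : Set where
      none : Dressed R a
      _◂_  : DressedCycle R a → Dressed R a → Dressed R a

    -- a term (a)(a μ₂)(μ₂)'_{R∖{a}}(μ₂μ₃)⋯(μₘ)'_{R∖{a,μ₂,…,μₘ₋₁}}(μₘ a)(a)
    -- for a simple cycle (a μ₂ ⋯ μₘ a) ∈ Γ_{R;a}
    data DressedCycle (R : Subset n) (a : Fin n) : Set where
      cyc : ∀ {b} (e : Edge a b) (w : Walk b a) → .(IsSimpleCycleOn R e w) →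
            DressInner (R - a) w → DressedCycle R a

    data DressInner : Subset n → ∀ {b c} → Walk b c → Set where
      end : ∀ {R c} → DressInner R (triv c)
      mid : ∀ {R a b c} {e : Edge a b} {w : Walk b c} →
            Dressed R a → DressInner (R - a) w → DressInner R (step e w)

  data DressPath : Subset n → ∀ {b c} → Walk b c → Set where
    last : ∀ {R c} → Dressed R c → DressPath R (triv c)
    mid  : ∀ {R a b c} {e : Edge a b} {w : Walk b c} →
           Dressed R a → DressPath (R - a) w → DressPath R (step e w)

  -- index set of the right-hand side: a simple path in Π_{G;αω}
  -- together with a choice of term in each dressed vertex
  data PathTerm (α ω : Fin n) : Set where
    path : (w : Walk α ω) → .(IsSimplePath w) → DressPath full w → PathTerm α ω

  mutual
    flatD : ∀ {R a} → Dressed R a → Walk a a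
    flatD {a = a} none = triv a
    flatD (c ◂ d) = flatC c ++w flatD d

    flatC : ∀ {R a} → DressedCycle R a → Walk a a
    flatC (cyc e w _ ds) = step e (flatI ds)

    flatI : ∀ {R b c} {w : Walk b c} → DressInner R w → Walk b c
    flatI {c = c} end = triv c
    flatI (mid {e = e} d ds) = flatD d ++w step e (flatI ds)

  flatP : ∀ {R b c} {w : Walk b c} → DressPath R w → Walk b c
  flatP (last d) = flatD d
  flatP (mid {e = e} d ds) = flatD d ++w step e (flatP ds)

  flatPath : ∀ {α ω} → PathTerm α ω → Walk α ω
  flatPath (path w _ ds) = flatP ds

module Submission where

-- Two canonical decompositions of walks drive the proof.
--   * First return: a closed walk at a, if non-trivial, is a first edge,
--     a walk back to a avoiding a in between, and a closed walk at a.
--   * Last exit: a walk from b is a closed walk at b followed by the walk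
--     after the last departure from b, which never meets b again.
-- Both decompositions are unique (first-return-unique, last-exit-unique);
-- this gives injectivity, once the support invariants show that a flattened
-- dressing on R - b never visits b.  Conversely, iterating the decompositions
-- builds a preimage of every walk: the first-return pieces of a closed walk
-- are its dressed simple cycles and the last-exit vertices of a walk are the
-- vertices of its simple-path skeleton.  The construction is by recursion on
-- a fuel bound for the length of the walk.

open import Defs
open import Data.Nat using (ℕ; zero; suc; _+_; _<_; s≤s⁻¹)
open import Data.Nat.Properties using (≤-refl; ≤-<-trans; m≤m+n; m≤n+m)
open import Data.Bool using (Bool)
open import Data.Fin using (Fin; zero; suc; _≟_)
open import Data.Fin.Subset using (Subset; _∈_; _∉_; _-_; _─_; inside; outside) renaming (⊤ to full)
open import Data.Fin.Subset.Properties using (x∈p∧x≢y⇒x∈p-y; p─q⊆p; x∈⁅x⁆; ∈⊤; _∈?_)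
open import Data.Vec.Base using (there; _∷_)
open import Data.Empty using (⊥; ⊥-elim)
open import Data.List using (List; []; _∷_; _++_; _∷ʳ_)
open import Data.List.Relation.Unary.All as All using (All; []; _∷_; all?)
open import Data.List.Relation.Unary.All.Properties using (++⁺; ++⁻; ∷ʳ⁺; ∷ʳ⁻)
open import Data.List.Relation.Unary.AllPairs using ([]; _∷_)
open import Data.List.Relation.Unary.Unique.Propositional using (Unique)
open import Data.Product using (Σ; ∃; _×_; _,_; proj₁; proj₂)
open import Function using (_∘_)
open import Relation.Nullary using (Dec; yes; no)
open import Relation.Nullary.Decidable using (_×-dec_; recompute)
open import Relation.Binary.PropositionalEquality using (_≡_; _≢_; refl; sym; cong; cong₂; subst)
open import Function.Definitions using (Bijective)

x∈p─q⇒x∉q : ∀ {n} {p q : Subset n} {x} → x ∈ p ─ q → x ∉ q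
x∈p─q⇒x∉q {p = _ ∷ _} {outside ∷ _} {zero}  _         ()
x∈p─q⇒x∉q {p = _ ∷ _} {inside ∷ _}  {zero}  ()
x∈p─q⇒x∉q {p = _ ∷ _} {_ ∷ _}       {suc x} (there h) (there h′) = x∈p─q⇒x∉q h h′

x∉p-x : ∀ {n} {p : Subset n} {x} → x ∉ p - x
x∉p-x {x = x} h = x∈p─q⇒x∉q h (x∈⁅x⁆ x)

x∈p-y⇒x∈p : ∀ {n} {p : Subset n} {x y} → x ∈ p - y → x ∈ p
x∈p-y⇒x∈p {p = p} = p─q⊆p p _

+-<-parts : ∀ {m n o} → m + n < o → m < o × n < o
+-<-parts h = ≤-<-trans (m≤m+n _ _) h , ≤-<-trans (m≤n+m _ _) h

module Decomposition (n : ℕ) (E : Fin n → Fin n → Bool) where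
  open Quiver n E
  open import Data.List.Relation.Unary.Unique.DecPropositional (_≟_ {n}) using (unique?)

  V : Set
  V = Fin n

  Avoid : V → List V → Set
  Avoid a = All (a ≢_)

  AllIn : Subset n → List V → Set
  AllIn R = All (_∈ R)

  AllIn-remove : ∀ {R b xs} → AllIn R xs → Avoid b xs → AllIn (R - b) xs
  AllIn-remove ins av = All.zipWith (λ { (x∈R , b≢x) → x∈p∧x≢y⇒x∈p-y x∈R (b≢x ∘ sym) }) (ins , av)

  AllIn-unremove : ∀ {R b xs} → AllIn (R - b) xs → AllIn R xs
  AllIn-unremove = All.map x∈p-y⇒x∈p

  AllIn-remove⇒Avoid : ∀ {R b xs} → AllIn (R - b) xs → Avoid b xs
  AllIn-remove⇒Avoid = All.map (λ x∈R-b b≡x → x∉p-x (subst (_∈ _) (sym b≡x) x∈R-b))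

  verts-∷ʳ : ∀ {a b} (w : Walk a b) → verts w ≡ initVerts w ∷ʳ b
  verts-∷ʳ (triv _)   = refl
  verts-∷ʳ (step e w) = cong (_ ∷_) (verts-∷ʳ w)

  initVerts-++ : ∀ {a b c} (u : Walk a b) (v : Walk b c) →
                 initVerts (u ++w v) ≡ initVerts u ++ initVerts v
  initVerts-++ (triv _)   v = refl
  initVerts-++ (step e u) v = cong (_ ∷_) (initVerts-++ u v)

  verts-++ : ∀ {a b c} (u : Walk a b) (v : Walk b c) → verts (u ++w v) ≡ initVerts u ++ verts v
  verts-++ (triv _)   v = refl
  verts-++ (step e u) v = cong (_ ∷_) (verts-++ u v)

  module _ {P : V → Set} where
    All-verts⁻ : ∀ {a b} (w : Walk a b) → All P (verts w) → All P (initVerts w) × P b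
    All-verts⁻ w = ∷ʳ⁻ ∘ subst (All P) (verts-∷ʳ w)

    All-verts⁺ : ∀ {a b} (w : Walk a b) → All P (initVerts w) → P b → All P (verts w)
    All-verts⁺ w ps p = subst (All P) (sym (verts-∷ʳ w)) (∷ʳ⁺ ps p)

    All-verts-start : ∀ {a b} (w : Walk a b) → All P (verts w) → P a
    All-verts-start (triv _)   (p ∷ _) = p
    All-verts-start (step e w) (p ∷ _) = p

    All-initVerts-++⁻ : ∀ {a b c} (u : Walk a b) (v : Walk b c) →
                        All P (initVerts (u ++w v)) → All P (initVerts u) × All P (initVerts v)
    All-initVerts-++⁻ u v = ++⁻ (initVerts u) ∘ subst (All P) (initVerts-++ u v)

    All-initVerts-++⁺ : ∀ {a b c} (u : Walk a b) (v : Walk b c) →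
                        All P (initVerts u) → All P (initVerts v) → All P (initVerts (u ++w v))
    All-initVerts-++⁺ u v ps qs = subst (All P) (sym (initVerts-++ u v)) (++⁺ ps qs)

    All-verts-++⁻ : ∀ {a b c} (u : Walk a b) (v : Walk b c) →
                    All P (verts (u ++w v)) → All P (initVerts u) × All P (verts v)
    All-verts-++⁻ u v = ++⁻ (initVerts u) ∘ subst (All P) (verts-++ u v)

    All-verts-++⁺ : ∀ {a b c} (u : Walk a b) (v : Walk b c) →
                    All P (initVerts u) → All P (verts v) → All P (verts (u ++w v))
    All-verts-++⁺ u v ps qs = subst (All P) (sym (verts-++ u v)) (++⁺ ps qs)

  passes-through : ∀ {a b c} (u : Walk a b) (v : Walk b c) → Avoid b (verts (u ++w v)) → ⊥
  passes-through u v av = All-verts-start v (proj₂ (All-verts-++⁻ u v av)) refl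

  triv≢++step : ∀ {a b k} (u : Walk a b) (e : Edge b k) (x : Walk k a) → triv a ≢ u ++w step e x
  triv≢++step (triv _)   e x ()
  triv≢++step (step _ u) e x ()

  len : ∀ {a b} → Walk a b → ℕ
  len (triv _)   = 0
  len (step e w) = suc (len w)

  len-++ : ∀ {a b c} (u : Walk a b) (v : Walk b c) → len (u ++w v) ≡ len u + len v
  len-++ (triv _)   v = refl
  len-++ (step e u) v = cong suc (len-++ u v)

  len-++step : ∀ {a b k c} (u : Walk a b) (e : Edge b k) (v : Walk k c) →
               len (u ++w step e v) ≡ suc (len u + len v)
  len-++step (triv _)   e v = refl
  len-++step (step f u) e v = cong suc (len-++step u e v)

  len-++-< : ∀ {K a b c} (u : Walk a b) (v : Walk b c) → len (u ++w v) < K → len u < K × len v < K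
  len-++-< {K} u v h = +-<-parts (subst (_< K) (len-++ u v) h)

  len-++step-< : ∀ {K a b k c} (u : Walk a b) (e : Edge b k) (v : Walk k c) →
                 len (u ++w step e v) < suc K → len u < K × len v < K
  len-++step-< {K} u e v h = +-<-parts (s≤s⁻¹ (subst (_< suc K) (len-++step u e v) h))

  data SameStep {a c : V} : ∀ {k₁ k₂} → Edge a k₁ → Walk k₁ c → Edge a k₂ → Walk k₂ c → Set where
    same : ∀ {k} {e : Edge a k} {r₁ r₂ : Walk k c} → r₁ ≡ r₂ → SameStep e r₁ e r₂

  step-injective : ∀ {a k₁ k₂ c} {e₁ : Edge a k₁} {e₂ : Edge a k₂} {r₁ : Walk k₁ c} {r₂ : Walk k₂ c} →
                   step e₁ r₁ ≡ step e₂ r₂ → SameStep e₁ r₁ e₂ r₂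
  step-injective refl = same refl

  first-return-unique : ∀ {b a c} (x₁ x₂ : Walk b a) (v₁ v₂ : Walk a c) →
                        Avoid a (initVerts x₁) → Avoid a (initVerts x₂) →
                        x₁ ++w v₁ ≡ x₂ ++w v₂ → x₁ ≡ x₂ × v₁ ≡ v₂
  first-return-unique (triv _)     (triv _)     v₁ v₂ _         _         eq = refl , eq
  first-return-unique (triv _)     (step _ _)   v₁ v₂ _         (a≢a ∷ _) _  = ⊥-elim (a≢a refl)
  first-return-unique (step _ _)   (triv _)     v₁ v₂ (a≢a ∷ _) _         _  = ⊥-elim (a≢a refl)
  first-return-unique (step e₁ x₁) (step e₂ x₂) v₁ v₂ (_ ∷ av₁) (_ ∷ av₂) eq with step-injective eq
  ... | same eq′ with first-return-unique x₁ x₂ v₁ v₂ av₁ av₂ eq′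
  ...   | refl , v₁≡v₂ = refl , v₁≡v₂

  last-exit-unique : ∀ {m b k₁ k₂ c} (u₁ u₂ : Walk m b) (e₁ : Edge b k₁) (e₂ : Edge b k₂)
                     (x₁ : Walk k₁ c) (x₂ : Walk k₂ c) → Avoid b (verts x₁) → Avoid b (verts x₂) →
                     u₁ ++w step e₁ x₁ ≡ u₂ ++w step e₂ x₂ → u₁ ≡ u₂ × SameStep e₁ x₁ e₂ x₂
  last-exit-unique (triv _) (triv _) e₁ e₂ x₁ x₂ _ _ eq = refl , step-injective eq
  last-exit-unique (triv _) (step f u₂) e₁ e₂ x₁ x₂ av₁ _ eq with step-injective eq
  ... | same eq′ =
    ⊥-elim (passes-through u₂ (step e₂ x₂) (subst (λ t → Avoid _ (verts t)) eq′ av₁))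
  last-exit-unique (step f u₁) (triv _) e₁ e₂ x₁ x₂ _ av₂ eq with step-injective eq
  ... | same eq′ =
    ⊥-elim (passes-through u₁ (step e₁ x₁) (subst (λ t → Avoid _ (verts t)) (sym eq′) av₂))
  last-exit-unique (step f₁ u₁) (step f₂ u₂) e₁ e₂ x₁ x₂ av₁ av₂ eq with step-injective eq
  ... | same eq′ with last-exit-unique u₁ u₂ e₁ e₂ x₁ x₂ av₁ av₂ eq′
  ...   | refl , s = refl , s

  data FirstVisit (a : V) : ∀ {b c} → Walk b c → Set where
    hit  : ∀ {b c} (y : Walk b a) (z : Walk a c) → Avoid a (initVerts y) → FirstVisit a (y ++w z)
    miss : ∀ {b c} {x : Walk b c} → Avoid a (verts x) → FirstVisit a x

  firstVisit : ∀ a {b c} (x : Walk b c) → FirstVisit a x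
  firstVisit a (triv b) with b ≟ a
  ... | yes refl = hit (triv a) (triv a) []
  ... | no b≢a   = miss ((b≢a ∘ sym) ∷ [])
  firstVisit a (step {b} e x) with b ≟ a
  ... | yes refl = hit (triv a) (step e x) []
  ... | no b≢a with firstVisit a x
  ...   | hit y z av = hit (step e y) z ((b≢a ∘ sym) ∷ av)
  ...   | miss av    = miss ((b≢a ∘ sym) ∷ av)

  data LastExit (b : V) : ∀ {m c} → Walk m c → Set where
    atEnd : ∀ {m} (y : Walk m b) → LastExit b y
    after : ∀ {m k c} (y : Walk m b) (e : Edge b k) (z : Walk k c) → Avoid b (verts z) →
            LastExit b (y ++w step e z)
    never : ∀ {m c} {x : Walk m c} → Avoid b (verts x) → LastExit b x

  lastExit : ∀ b {m c} (x : Walk m c) → LastExit b x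
  lastExit b (triv m) with m ≟ b
  ... | yes refl = atEnd (triv b)
  ... | no m≢b   = never ((m≢b ∘ sym) ∷ [])
  lastExit b (step {m} e x) with lastExit b x
  ... | atEnd y        = atEnd (step e y)
  ... | after y e′ z av = after (step e y) e′ z av
  ... | never av with m ≟ b
  ...   | yes refl = after (triv b) e x av
  ...   | no m≢b   = never ((m≢b ∘ sym) ∷ av)

  SimpleIn : Subset n → List V → Set
  SimpleIn R xs = AllIn R xs × Unique xs

  SimpleIn-∷ : ∀ {R b xs} → b ∈ R → SimpleIn (R - b) xs → SimpleIn R (b ∷ xs)
  SimpleIn-∷ b∈R (ins , distinct) = (b∈R ∷ AllIn-unremove ins) , (AllIn-remove⇒Avoid ins ∷ distinct)

  SimpleIn-tail : ∀ {R b xs} → SimpleIn R (b ∷ xs) → SimpleIn (R - b) xs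
  SimpleIn-tail ((_ ∷ ins) , (b-avoids ∷ distinct)) = AllIn-remove ins b-avoids , distinct

  -- Simple-cycle conditions are decidable, so the irrelevant proofs stored
  -- in dressed cycles can be recomputed.
  isSimpleCycleOn? : ∀ R {a b} (e : Edge a b) (w : Walk b a) → Dec (IsSimpleCycleOn R e w)
  isSimpleCycleOn? R {a} e w = unique? (a ∷ initVerts w) ×-dec all? (_∈? R) (verts (step e w))

  simple-cycle-interior : ∀ R {a b} (e : Edge a b) (w : Walk b a) → .(IsSimpleCycleOn R e w) →
                          a ∈ R × SimpleIn (R - a) (initVerts w)
  simple-cycle-interior R e w prf with recompute (isSimpleCycleOn? R e w) prf
  ... | distinct , (a∈R ∷ vs) = a∈R , SimpleIn-tail ((a∈R ∷ proj₁ (All-verts⁻ w vs)) , distinct)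

  mutual
    dressed-support : ∀ {R a} (d : Dressed R a) → a ∈ R → AllIn R (verts (flatD d))
    dressed-support none    a∈R = a∈R ∷ []
    dressed-support (c ◂ d) a∈R =
      All-verts-++⁺ (flatC c) (flatD d) (cycle-support c) (dressed-support d a∈R)

    cycle-support : ∀ {R a} (c : DressedCycle R a) → AllIn R (initVerts (flatC c))
    cycle-support {R} (cyc e w prf ds) with simple-cycle-interior R e w prf
    ... | a∈R , simple = a∈R ∷ AllIn-unremove (inner-support ds simple)

    inner-support : ∀ {R b c} {w : Walk b c} (ds : DressInner R w) →
                    SimpleIn R (initVerts w) → AllIn R (initVerts (flatI ds))
    inner-support end _ = []
    inner-support (mid {e = e} d ds) simple@((b∈R ∷ _) , _) =
      All-initVerts-++⁺ (flatD d) (step e (flatI ds))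
        (proj₁ (All-verts⁻ (flatD d) (dressed-support d b∈R)))
        (b∈R ∷ AllIn-unremove (inner-support ds (SimpleIn-tail simple)))

  path-support : ∀ {R b c} {w : Walk b c} (ds : DressPath R w) →
                 SimpleIn R (verts w) → AllIn R (verts (flatP ds))
  path-support (last d) ((c∈R ∷ []) , _) = dressed-support d c∈R
  path-support (mid {e = e} d ds) simple@((b∈R ∷ _) , _) =
    All-verts-++⁺ (flatD d) (step e (flatP ds))
      (proj₁ (All-verts⁻ (flatD d) (dressed-support d b∈R)))
      (b∈R ∷ AllIn-unremove (path-support ds (SimpleIn-tail simple)))

  inner-avoids : ∀ {R b k c} {w : Walk k c} (ds : DressInner (R - b) w) →
                 SimpleIn (R - b) (initVerts w) → b ≢ c → Avoid b (verts (flatI ds))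
  inner-avoids ds simple b≢c =
    All-verts⁺ (flatI ds) (AllIn-remove⇒Avoid (inner-support ds simple)) b≢c

  path-avoids : ∀ {R b k c} {w : Walk k c} (ds : DressPath (R - b) w) →
                SimpleIn (R - b) (verts w) → Avoid b (verts (flatP ds))
  path-avoids ds simple = AllIn-remove⇒Avoid (path-support ds simple)

  -- Injectivity: peel off the first dressed cycle (first return) or the
  -- last exit from the current skeleton vertex, using uniqueness of both.
  mutual
    dressed-injective : ∀ {R a} (d₁ d₂ : Dressed R a) → flatD d₁ ≡ flatD d₂ → d₁ ≡ d₂
    dressed-injective none none _ = refl
    dressed-injective none (cyc _ _ _ _ ◂ _) ()
    dressed-injective (cyc _ _ _ _ ◂ _) none ()
    dressed-injective {R} (cyc e₁ w₁ p₁ ds₁ ◂ d₁) (cyc e₂ w₂ p₂ ds₂ ◂ d₂) eq with step-injective eq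
    ... | same eq′ with simple-cycle-interior R e₁ w₁ p₁ | simple-cycle-interior R e₂ w₂ p₂
    ...   | _ , s₁ | _ , s₂
      with first-return-unique (flatI ds₁) (flatI ds₂) (flatD d₁) (flatD d₂)
             (AllIn-remove⇒Avoid (inner-support ds₁ s₁)) (AllIn-remove⇒Avoid (inner-support ds₂ s₂)) eq′
    ...     | eqI , eqD with dressed-injective d₁ d₂ eqD | inner-injective ds₁ ds₂ s₁ s₂ x∉p-x eqI
    ...       | refl | refl = refl

    inner-injective : ∀ {R b c} {w₁ w₂ : Walk b c} (ds₁ : DressInner R w₁) (ds₂ : DressInner R w₂) →
                      SimpleIn R (initVerts w₁) → SimpleIn R (initVerts w₂) → c ∉ R →
                      flatI ds₁ ≡ flatI ds₂ → _≡_ {A = Σ (Walk b c) (DressInner R)} (w₁ , ds₁) (w₂ , ds₂)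
    inner-injective end end _ _ _ _ = refl
    inner-injective end (mid {e = e} d ds) _ _ _ eq = ⊥-elim (triv≢++step (flatD d) e (flatI ds) eq)
    inner-injective (mid {e = e} d ds) end _ _ _ eq = ⊥-elim (triv≢++step (flatD d) e (flatI ds) (sym eq))
    inner-injective {R} {b} {c} (mid {e = e₁} d₁ ds₁) (mid {e = e₂} d₂ ds₂) s₁@((b∈R ∷ _) , _) s₂ c∉R eq
      with last-exit-unique (flatD d₁) (flatD d₂) e₁ e₂ (flatI ds₁) (flatI ds₂)
             (inner-avoids ds₁ (SimpleIn-tail s₁) b≢c) (inner-avoids ds₂ (SimpleIn-tail s₂) b≢c) eq
      where
      b≢c : b ≢ c
      b≢c refl = c∉R b∈R
    ... | eqD , same eqI
      with dressed-injective d₁ d₂ eqD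
         | inner-injective ds₁ ds₂ (SimpleIn-tail s₁) (SimpleIn-tail s₂) (c∉R ∘ x∈p-y⇒x∈p) eqI
    ...   | refl | refl = refl

  path-injective : ∀ {R b c} {w₁ w₂ : Walk b c} (ds₁ : DressPath R w₁) (ds₂ : DressPath R w₂) →
                   SimpleIn R (verts w₁) → SimpleIn R (verts w₂) →
                   flatP ds₁ ≡ flatP ds₂ → _≡_ {A = Σ (Walk b c) (DressPath R)} (w₁ , ds₁) (w₂ , ds₂)
  path-injective (last d₁) (last d₂) _ _ eq with dressed-injective d₁ d₂ eq
  ... | refl = refl
  path-injective (last _) (mid d ds) _ s₂ _ =
    ⊥-elim (proj₂ (All-verts⁻ (flatP ds) (path-avoids ds (SimpleIn-tail s₂))) refl)
  path-injective (mid d ds) (last _) s₁ _ _ =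
    ⊥-elim (proj₂ (All-verts⁻ (flatP ds) (path-avoids ds (SimpleIn-tail s₁))) refl)
  path-injective (mid {e = e₁} d₁ ds₁) (mid {e = e₂} d₂ ds₂) s₁ s₂ eq
    with last-exit-unique (flatD d₁) (flatD d₂) e₁ e₂ (flatP ds₁) (flatP ds₂)
           (path-avoids ds₁ (SimpleIn-tail s₁)) (path-avoids ds₂ (SimpleIn-tail s₂)) eq
  ... | eqD , same eqP
    with dressed-injective d₁ d₂ eqD | path-injective ds₁ ds₂ (SimpleIn-tail s₁) (SimpleIn-tail s₂) eqP
  ...   | refl | refl = refl

  AllIn-full : (xs : List V) → AllIn full xs
  AllIn-full []       = []
  AllIn-full (x ∷ xs) = ∈⊤ ∷ AllIn-full xs

  skeleton-simple : ∀ {α ω} (w : Walk α ω) → .(IsSimplePath w) → SimpleIn full (verts w)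
  skeleton-simple w p = AllIn-full _ , recompute (unique? (verts w)) p

  flatPath-injective : ∀ {α ω} (t₁ t₂ : PathTerm α ω) → flatPath t₁ ≡ flatPath t₂ → t₁ ≡ t₂
  flatPath-injective (path w₁ p₁ ds₁) (path w₂ p₂ ds₂) eq
    with path-injective ds₁ ds₂ (skeleton-simple w₁ p₁) (skeleton-simple w₂ p₂) eq
  ... | refl = refl

  record InnerDecomposition (R : Subset n) {b c} (u : Walk b c) : Set where
    constructor inner-decomposed
    field
      skeleton : Walk b c
      simple   : SimpleIn R (initVerts skeleton)
      dressing : DressInner R skeleton
      flattens : flatI dressing ≡ u

  record PathDecomposition (R : Subset n) {b c} (u : Walk b c) : Set where
    constructor path-decomposed
    field
      skeleton : Walk b c
      simple   : SimpleIn R (verts skeleton)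
      dressing : DressPath R skeleton
      flattens : flatP dressing ≡ u

  closed-outside-decomposition : ∀ {R b} (u : Walk b b) → AllIn R (initVerts u) → b ∉ R →
                                 InnerDecomposition R u
  closed-outside-decomposition (triv b)   _         _   = inner-decomposed (triv b) ([] , []) end refl
  closed-outside-decomposition (step _ _) (b∈R ∷ _) b∉R = ⊥-elim (b∉R b∈R)

  -- A closed walk at a in R is dressed on R by splitting off
  -- first-return cycles; the interior of a cycle is decomposed on R - a by
  -- last exits.
  mutual
    dress-closed : ∀ K {R a} (w : Walk a a) → len w < K → AllIn R (verts w) →
                   Σ (Dressed R a) λ d → flatD d ≡ w
    dress-closed zero w () _
    dress-closed (suc K) (triv a) _ _ = none , refl
    dress-closed (suc K) {R} {a} (step e x) lw (a∈R ∷ vs) with firstVisit a x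
    ... | miss av = ⊥-elim (proj₂ (All-verts⁻ x av) refl)
    ... | hit y z av with len-++-< y z (s≤s⁻¹ lw) | All-verts-++⁻ y z vs
    ...   | ly , lz | iy , vz
      with decompose-inner K y ly (AllIn-remove iy av) x∉p-x | dress-closed K z lz vz
    ...     | inner-decomposed p simple ds eqI | d , eqD =
      (cyc e p simple-cycle ds ◂ d) , cong (step e) (cong₂ _++w_ eqI eqD)
      where
      simple-cycle : IsSimpleCycleOn R e p
      simple-cycle = proj₂ (SimpleIn-∷ a∈R simple)
                   , (a∈R ∷ All-verts⁺ p (AllIn-unremove (proj₁ simple)) a∈R)

    decompose-inner : ∀ K {R b c} (u : Walk b c) → len u < K → AllIn R (initVerts u) → c ∉ R →
                      InnerDecomposition R u
    decompose-inner zero u () _ _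
    decompose-inner (suc K) {R} {b} u lu ins c∉R with lastExit b u
    ... | atEnd y  = closed-outside-decomposition y ins c∉R
    ... | never av = ⊥-elim (All-verts-start u av refl)
    ... | after y e z av with len-++step-< y e z lu | All-initVerts-++⁻ y (step e z) ins
    ...   | ly , lz | iy , (b∈R ∷ iz)
      with dress-closed K y ly (All-verts⁺ y iy b∈R)
         | decompose-inner K z lz (AllIn-remove iz (proj₁ (All-verts⁻ z av))) (c∉R ∘ x∈p-y⇒x∈p)
    ...     | d , eqD | inner-decomposed p simple ds eqI =
      inner-decomposed (step e p) (SimpleIn-∷ b∈R simple) (mid d ds)
                       (cong₂ (λ s t → s ++w step e t) eqD eqI)

  decompose-path : ∀ K {R b c} (w : Walk b c) → len w < K → AllIn R (verts w) → PathDecomposition R w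
  decompose-path zero w () _
  decompose-path (suc K) {R} {b} w lw vs with lastExit b w
  ... | atEnd y with dress-closed (suc K) y lw vs
  ...   | d , eqD = path-decomposed (triv b) ((All-verts-start y vs ∷ []) , ([] ∷ [])) (last d) eqD
  decompose-path (suc K) {R} {b} w lw vs | never av = ⊥-elim (All-verts-start w av refl)
  decompose-path (suc K) {R} {b} w lw vs | after y e z av
    with len-++step-< y e z lw | All-verts-++⁻ y (step e z) vs
  ... | ly , lz | iy , (b∈R ∷ vz)
    with dress-closed K y ly (All-verts⁺ y iy b∈R) | decompose-path K z lz (AllIn-remove vz av)
  ...   | d , eqD | path-decomposed p simple ds eqP =
    path-decomposed (step e p) (SimpleIn-∷ b∈R simple) (mid d ds)
                    (cong₂ (λ s t → s ++w step e t) eqD eqP)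

  flatPath-surjective : ∀ {α ω} (w : Walk α ω) → ∃ λ t → ∀ {t′} → t′ ≡ t → flatPath t′ ≡ w
  flatPath-surjective w with decompose-path (suc (len w)) w ≤-refl (AllIn-full _)
  ... | path-decomposed p (_ , distinct) ds eq = path p distinct ds , λ { refl → eq }

corollary1 : (n : ℕ) (E : Fin n → Fin n → Bool) (α ω : Fin n) →
    Bijective _≡_ _≡_ (Quiver.flatPath n E {α} {ω})
corollary1 n E α ω = (λ {t₁} {t₂} → flatPath-injective t₁ t₂) , flatPath-surjective
  where open Decomposition n E
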